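{- Let $N\ge R\ge1$ be integers, let $A(N,R)$ be the set of integer sequences $c=(c_1,\dots,c_R)$ with $1\le c_1<\cdots<c_R\le N$, and let $L(N,R,c)$ be the position of $c$ in $A(N,R)$ ordered lexicographically (the smallest element having position $1$). Let $c\in A(N,R)$ and $m=L(N,R,c)$. Put $m_1=m$ and, for $i=2,\dots,R$, $$m_i=m-\sum_{l=1}^{i-1}\left(\binom{N-l}{R-l+1}-\binom{N-c_l}{R-l+1}\right).$$ Then for each $i=1,\dots,R$, $c_i$ is characterized as the unique integer $j$ with $i\le j\le N-R+i$ satisfying $$\binom{N-i+1}{R-i+1}-\binom{N-j+1}{R-i+1}<m_i\le\binom{N-i+1}{R-i+1}-\binom{N-j}{R-i+1}.$$
   Context: Binomial coefficients $\binom{n}{m}$ are the usual ones for integers $n\ge m\ge0$, with the additional convention $\binom{n}{n+1}=0$. Note $m_i$ depends only on $c_1,\dots,c_{i-1}$. -}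

module Defs where

open import Data.Nat using (ℕ; zero; suc; _≤_; _<_; _∸_; _≤?_; _<?_)
import Data.Nat as ℕ
open import Data.Nat.Properties using (_≟_)
open import Data.Nat.Combinatorics using (_C_)
open import Data.Integer as ℤ using (ℤ; +_)
open import Data.Fin as Fin using (Fin)
import Data.Fin.Properties as FinP
open import Data.Vec using (Vec; []; _∷_; lookup)
open import Data.List using (List; []; _∷_; [_]; map; concatMap; filter; length; applyUpTo; foldr)
open import Data.Product using (_×_; _,_)
open import Data.Sum using (_⊎_; inj₁; inj₂)
open import Relation.Binary.PropositionalEquality using (_≡_; refl)
open import Relation.Nullary using (Dec; yes; no; ¬_)
open import Relation.Nullary.Decidable using (_×-dec_; _→-dec_)

InA : (N R : ℕ) → Vec ℕ R → Set
InA N R c = (∀ k → 1 ≤ lookup c k × lookup c k ≤ N)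
          × (∀ k k′ → k Fin.< k′ → lookup c k < lookup c k′)

inA? : (N R : ℕ) → (c : Vec ℕ R) → Dec (InA N R c)
inA? N R c = FinP.all? (λ k → (1 ≤? lookup c k) ×-dec (lookup c k ≤? N))
       ×-dec FinP.all? (λ k → FinP.all? (λ k′ →
               (k Fin.<? k′) →-dec (lookup c k <? lookup c k′)))

data _<lex_ : {n : ℕ} → Vec ℕ n → Vec ℕ n → Set where
  here  : ∀ {n x y} {xs ys : Vec ℕ n} → x < y → (x ∷ xs) <lex (y ∷ ys)
  there : ∀ {n x} {xs ys : Vec ℕ n} → xs <lex ys → (x ∷ xs) <lex (x ∷ ys)

lex? : {n : ℕ} → (xs ys : Vec ℕ n) → Dec (xs <lex ys)
lex? [] [] = no λ ()
lex? (x ∷ xs) (y ∷ ys) with x <? y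
... | yes p = yes (here p)
... | no ¬p with x ≟ y
...   | no x≢y = no λ { (here q) → ¬p q ; (there _) → x≢y refl }
...   | yes refl with lex? xs ys
...     | yes q = yes (there q)
...     | no ¬q = no λ { (here q) → ¬p q ; (there q) → ¬q q }

allVecs : (N R : ℕ) → List (Vec ℕ R)
allVecs N zero    = [ [] ]
allVecs N (suc R) = concatMap (λ x → map (x ∷_) (allVecs N R)) (applyUpTo suc N)

-- L(N,R,c): position of c in A(N,R) ordered lexicographically (smallest has position 1),
-- i.e. 1 + #{ d ∈ A(N,R) : d <lex c }.
L : (N R : ℕ) → Vec ℕ R → ℕ
L N R c = suc (length (filter (λ d → inA? N R d ×-dec lex? d c) (allVecs N R)))

-- c_l, 1-indexed (c_1 is the head); value 0 outside 1..R (never used there).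
nth : {R : ℕ} → Vec ℕ R → ℕ → ℕ
nth []       _             = 0
nth (x ∷ xs) zero          = 0
nth (x ∷ xs) (suc zero)    = x
nth (x ∷ xs) (suc (suc l)) = nth xs (suc l)

sumℤ : List ℤ → ℤ
sumℤ = foldr ℤ._+_ (+ 0)

-- m_i = m − Σ_{l=1}^{i−1} ( C(N−l, R−l+1) − C(N−c_l, R−l+1) )   (so m_1 = m).
-- Binomials are stdlib's _C_, which is 0 when k > n (covering C(n,n+1)=0).
mSeq : (N R : ℕ) → Vec ℕ R → ℕ → ℕ → ℤ
mSeq N R c m i = + m ℤ.- sumℤ (map term (applyUpTo suc (i ∸ 1)))
  where
  term : ℕ → ℤ
  term l = + ((N ∸ l) C (suc R ∸ l)) ℤ.- + ((N ∸ nth c l) C (suc R ∸ l))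

Char : (N R : ℕ) → ℤ → ℕ → ℕ → Set
Char N R mi i j =
  (+ ((suc N ∸ i) C (suc R ∸ i)) ℤ.- + ((suc N ∸ j) C (suc R ∸ i)) ℤ.< mi)
  × (mi ℤ.≤ + ((suc N ∸ i) C (suc R ∸ i)) ℤ.- + ((N ∸ j) C (suc R ∸ i)))

{-# OPTIONS --safe #-}
module Submission where

-- Sequences in A(N,R) whose first entry is smaller than x form a block of size
-- C(N,R) − C(N+1−x,R) (hockey stick), so the lexicographic rank satisfies
-- L = 1 + Σₗ (C(N−cₗ₋₁,R−l+1) − C(N+1−cₗ,R−l+1)), with c₀ = 0.  Subtracting
-- the first i−1 terms of the sum defining mᵢ leaves, by Pascal's rule,
--   mᵢ = 1 + Fᵢ + C(N+1−i,R−i+1) − C(N+1−cᵢ,R−i+1),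
-- where Fᵢ < C(N−cᵢ,R−i) is the rank of the tail (cᵢ₊₁,…,c_R) above cᵢ.
-- Writing C(N+1−cᵢ,R−i+1) = C(N−cᵢ,R−i) + C(N−cᵢ,R−i+1) puts mᵢ in the window
-- of cᵢ; the windows of different j are disjoint because j ↦ C(N+1−j,k) is
-- antitone.

open import Defs
open import Algebra.Core using (Op₂)
open import Algebra.Structures using (IsMonoid)
open import Data.Bool using (true; false)
open import Data.Empty using (⊥-elim)
import Data.Fin as Fin
open import Data.Integer as ℤ using (ℤ; +_)
import Data.Integer.Properties as ℤP
open import Data.Integer.Tactic.RingSolver using (solve-∀)
open import Data.List
  using (List; []; _∷_; [_]; _++_; _∷ʳ_; map; concatMap; filter; length; applyUpTo; foldr; drop)
open import Data.List.Properties
  using (applyUpTo-∷ʳ; map-++; filter-++; filter-≐; filter-none; filter-accept; length-++; length-drop)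
import Data.List.Relation.Unary.All as All
open import Data.Nat
  using (ℕ; zero; suc; _≤_; _<_; _+_; _∸_; _≤?_; _<?_; z≤n; s≤s; s≤s⁻¹; z<s; s<s; _≤′_; ≤′-refl; ≤′-step)
open import Data.Nat.Combinatorics using (_C_; nCk+nC[k+1]≡[n+1]C[k+1])
open import Data.Nat.ListAction using (sum)
open import Data.Nat.Properties
open import Data.Product using (_×_; _,_; proj₁; proj₂)
open import Data.Vec using (Vec; []; _∷_; toList; lookup)
open import Data.Vec.Properties using (length-toList)
open import Function using (_∘_)
open import Relation.Binary.Definitions using (tri<; tri≈; tri>)
open import Relation.Binary.PropositionalEquality hiding ([_])
open import Relation.Nullary using (¬_; does)
open import Relation.Nullary.Decidable using (_×-dec_)
open import Relation.Unary using (Decidable; _≐_)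

module _ {A : Set} {_∙_ : Op₂ A} {ε : A} (isMonoid : IsMonoid _≡_ _∙_ ε) where
  open IsMonoid isMonoid using (assoc; identityˡ; identityʳ)

  foldr-∷ʳ : ∀ xs x → foldr _∙_ ε (xs ∷ʳ x) ≡ foldr _∙_ ε xs ∙ x
  foldr-∷ʳ []       x = trans (identityʳ x) (sym (identityˡ x))
  foldr-∷ʳ (y ∷ ys) x = trans (cong (y ∙_) (foldr-∷ʳ ys x)) (sym (assoc y _ x))

  foldr-map-applyUpTo-suc : ∀ (f : ℕ → A) n →
    foldr _∙_ ε (map f (applyUpTo suc (suc n)))
      ≡ foldr _∙_ ε (map f (applyUpTo suc n)) ∙ f (suc n)
  foldr-map-applyUpTo-suc f n = begin
    foldr _∙_ ε (map f (applyUpTo suc (suc n)))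
      ≡⟨ cong (foldr _∙_ ε ∘ map f) (applyUpTo-∷ʳ suc n) ⟨
    foldr _∙_ ε (map f (applyUpTo suc n ∷ʳ suc n))
      ≡⟨ cong (foldr _∙_ ε) (map-++ f (applyUpTo suc n) [ suc n ]) ⟩
    foldr _∙_ ε (map f (applyUpTo suc n) ∷ʳ f (suc n))
      ≡⟨ foldr-∷ʳ (map f (applyUpTo suc n)) (f (suc n)) ⟩
    foldr _∙_ ε (map f (applyUpTo suc n)) ∙ f (suc n) ∎
    where open ≡-Reasoning

sumTo : ℕ → (ℕ → ℕ) → ℕ
sumTo zero    h = 0
sumTo (suc M) h = sumTo M h + h (suc M)

sum-applyUpTo : ∀ (h : ℕ → ℕ) M → sum (map h (applyUpTo suc M)) ≡ sumTo M h
sum-applyUpTo h zero    = refl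
sum-applyUpTo h (suc M) =
  trans (foldr-map-applyUpTo-suc +-0-isMonoid h M) (cong (_+ h (suc M)) (sum-applyUpTo h M))

sumTo-vanishing-tail : ∀ {M M′} (h : ℕ → ℕ) → (∀ {y} → M < y → y ≤ M′ → h y ≡ 0) →
                       M ≤ M′ → sumTo M′ h ≡ sumTo M h
sumTo-vanishing-tail {M} h vanish M≤M′ = go (≤⇒≤′ M≤M′) vanish
  where
  go : ∀ {M′} → M ≤′ M′ → (∀ {y} → M < y → y ≤ M′ → h y ≡ 0) → sumTo M′ h ≡ sumTo M h
  go ≤′-refl                _       = refl
  go (≤′-step {M′} M≤′M′) vanish′ = begin
    sumTo M′ h + h (suc M′) ≡⟨ cong (_+_ (sumTo M′ h)) (vanish′ (s≤s (≤′⇒≤ M≤′M′)) ≤-refl) ⟩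
    sumTo M′ h + 0          ≡⟨ +-identityʳ _ ⟩
    sumTo M′ h              ≡⟨ go M≤′M′ (λ M<y y≤M′ → vanish′ M<y (m≤n⇒m≤1+n y≤M′)) ⟩
    sumTo M h               ∎
    where open ≡-Reasoning

pascal-∸ : ∀ {n a m j} → a < n → j ≤ m →
           (n ∸ a) C (suc m ∸ j) ≡ (n ∸ suc a) C (m ∸ j) + (n ∸ suc a) C (suc m ∸ j)
pascal-∸ {n} {a} {m} {j} a<n j≤m rewrite +-∸-assoc 1 a<n | +-∸-assoc 1 j≤m =
  sym (nCk+nC[k+1]≡[n+1]C[k+1] (n ∸ suc a) (m ∸ j))

C-monoˡ-≤ : ∀ k {n n′} → n ≤ n′ → n C k ≤ n′ C k
C-monoˡ-≤ k n≤n′ = go (≤⇒≤′ n≤n′)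
  where
  nCk≤[1+n]Ck : ∀ n k → n C k ≤ suc n C k
  nCk≤[1+n]Ck n zero    = ≤-refl
  nCk≤[1+n]Ck n (suc k) = subst (n C suc k ≤_) (nCk+nC[k+1]≡[n+1]C[k+1] n k) (m≤n+m _ _)
  go : ∀ {n n′} → n ≤′ n′ → n C k ≤ n′ C k
  go ≤′-refl         = ≤-refl
  go (≤′-step n≤′n′) = ≤-trans (go n≤′n′) (nCk≤[1+n]Ck _ k)

[1+n∸b]Ck≤[n∸a]Ck : ∀ {n a b} k → a < b → (suc n ∸ b) C k ≤ (n ∸ a) C k
[1+n∸b]Ck≤[n∸a]Ck {n} k a<b = C-monoˡ-≤ k (∸-monoʳ-≤ (suc n) a<b)

hockey-stick : ∀ {N r lo M} (h : ℕ → ℕ) →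
               (∀ {y} → y ≤ lo → h y ≡ 0) → (∀ {y} → lo < y → y ≤ M → h y ≡ (N ∸ y) C r) →
               lo ≤ M → M ≤ N → sumTo M h + (N ∸ M) C suc r ≡ (N ∸ lo) C suc r
hockey-stick {N} {r} {lo} h vanish binomial lo≤M = go (≤⇒≤′ lo≤M) binomial
  where
  go : ∀ {M} → lo ≤′ M → (∀ {y} → lo < y → y ≤ M → h y ≡ (N ∸ y) C r) →
       M ≤ N → sumTo M h + (N ∸ M) C suc r ≡ (N ∸ lo) C suc r
  go ≤′-refl _ _ = cong (_+ (N ∸ lo) C suc r) (sumTo-vanishing-tail {0} h (λ _ → vanish) z≤n)
  go (≤′-step {M} lo≤′M) binomial′ M<N = begin
    sumTo M h + h (suc M) + (N ∸ suc M) C suc r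
      ≡⟨ cong (λ t → sumTo M h + t + (N ∸ suc M) C suc r) (binomial′ (s≤s (≤′⇒≤ lo≤′M)) ≤-refl) ⟩
    sumTo M h + (N ∸ suc M) C r + (N ∸ suc M) C suc r
      ≡⟨ +-assoc (sumTo M h) _ _ ⟩
    sumTo M h + ((N ∸ suc M) C r + (N ∸ suc M) C suc r)
      ≡⟨ cong (_+_ (sumTo M h)) (pascal-∸ M<N z≤n) ⟨
    sumTo M h + (N ∸ M) C suc r
      ≡⟨ go lo≤′M (λ lo<y y≤M → binomial′ lo<y (m≤n⇒m≤1+n y≤M)) (<⇒≤ M<N) ⟩
    (N ∸ lo) C suc r ∎
    where open ≡-Reasoning

sumTo-first-entries : ∀ {N r lo x F} (h : ℕ → ℕ) →
  (∀ {y} → y ≤ lo → h y ≡ 0) → (∀ {y} → lo < y → y < x → h y ≡ (N ∸ y) C r) →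
  h x ≡ F → (∀ {y} → x < y → y ≤ N → h y ≡ 0) →
  lo < x → x ≤ N → sumTo N h ≡ ((N ∸ lo) C suc r ∸ (suc N ∸ x) C suc r) + F
sumTo-first-entries {N} {r} {lo} {suc x} {F} h vanish binomial at-x beyond lo<x x<N = begin
  sumTo N h             ≡⟨ sumTo-vanishing-tail h beyond x<N ⟩
  sumTo x h + h (suc x) ≡⟨ cong₂ _+_ below-x at-x ⟩
  ((N ∸ lo) C suc r ∸ (N ∸ x) C suc r) + F ∎
  where
  open ≡-Reasoning
  below-x : sumTo x h ≡ (N ∸ lo) C suc r ∸ (N ∸ x) C suc r
  below-x = trans (sym (m+n∸n≡m (sumTo x h) ((N ∸ x) C suc r)))
    (cong (_∸ (N ∸ x) C suc r)
          (hockey-stick h vanish (λ lo<y y≤x → binomial lo<y (s≤s y≤x)) (s≤s⁻¹ lo<x) (<⇒≤ x<N)))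

count : ∀ {A : Set} {P : A → Set} → Decidable P → List A → ℕ
count P? = length ∘ filter P?

module _ {A : Set} where

  count-none : ∀ {P : A → Set} (P? : Decidable P) → (∀ a → ¬ P a) → ∀ xs → count P? xs ≡ 0
  count-none P? ¬P xs = cong length (filter-none P? (All.universal ¬P xs))

  count-≐ : ∀ {P Q : A → Set} (P? : Decidable P) (Q? : Decidable Q) → P ≐ Q →
            ∀ xs → count P? xs ≡ count Q? xs
  count-≐ P? Q? P≐Q xs = cong length (filter-≐ P? Q? P≐Q xs)

  count-++ : ∀ {P : A → Set} (P? : Decidable P) xs ys → count P? (xs ++ ys) ≡ count P? xs + count P? ys
  count-++ P? xs ys = trans (cong length (filter-++ P? xs ys)) (length-++ (filter P? xs))

  count-map : ∀ {B : Set} {P : A → Set} (P? : Decidable P) (f : B → A) xs →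
              count P? (map f xs) ≡ count (P? ∘ f) xs
  count-map P? f []       = refl
  count-map P? f (x ∷ xs) with does (P? (f x))
  ... | true  = cong suc (count-map P? f xs)
  ... | false = count-map P? f xs

  count-concatMap : ∀ {B C : Set} {P : A → Set} (P? : Decidable P) (g : B → C → A) (cs : List C) bs →
    count P? (concatMap (λ b → map (g b) cs) bs) ≡ sum (map (λ b → count (P? ∘ g b) cs) bs)
  count-concatMap P? g cs []       = refl
  count-concatMap P? g cs (b ∷ bs) = trans (count-++ P? (map (g b) cs) _)
    (cong₂ _+_ (count-map P? (g b) cs) (count-concatMap P? g cs bs))

count-allVecs-suc : ∀ N r {P : Vec ℕ (suc r) → Set} (P? : Decidable P) →
  count P? (allVecs N (suc r)) ≡ sumTo N (λ y → count (P? ∘ (y ∷_)) (allVecs N r))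
count-allVecs-suc N r P? =
  trans (count-concatMap P? _∷_ (allVecs N r) (applyUpTo suc N)) (sum-applyUpTo _ N)

window : ∀ {F B X} A Y → X ≡ B + Y → F < B →
  (+ A ℤ.- + X ℤ.< + (suc F + A) ℤ.- + X) × (+ (suc F + A) ℤ.- + X ℤ.≤ + A ℤ.- + Y)
window {F} {B} A Y refl F<B =
    ℤP.+-monoˡ-< (ℤ.- + (B + Y)) (ℤ.+<+ (m<n+m A z<s))
  , ℤP.≤-trans (ℤP.+-monoˡ-≤ (ℤ.- + (B + Y)) (ℤ.+≤+ (+-monoˡ-≤ A F<B)))
               (ℤP.≤-reflexive (cancel (+ B) (+ A) (+ Y)))
  where
  cancel : ∀ b a y → b ℤ.+ a ℤ.- (b ℤ.+ y) ≡ a ℤ.- y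
  cancel = solve-∀

Char-disjoint : ∀ {N R mᵢ i j j′} → j < j′ → Char N R mᵢ i j → ¬ Char N R mᵢ i j′
Char-disjoint {N} {R} {i = i} {j} {j′} j<j′ (_ , mᵢ≤hi) (lo′<mᵢ , _) =
  ℤP.<-irrefl refl (ℤP.≤-<-trans (ℤP.≤-trans mᵢ≤hi hi≤lo′) lo′<mᵢ)
  where
  A = (suc N ∸ i) C (suc R ∸ i)
  hi≤lo′ : + A ℤ.- + ((N ∸ j) C (suc R ∸ i)) ℤ.≤ + A ℤ.- + ((suc N ∸ j′) C (suc R ∸ i))
  hi≤lo′ = ℤP.+-monoʳ-≤ (+ A) (ℤP.neg-mono-≤ (ℤ.+≤+ ([1+n∸b]Ck≤[n∸a]Ck (suc R ∸ i) j<j′)))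

Char-unique : ∀ {N R mᵢ i j j′} → Char N R mᵢ i j → Char N R mᵢ i j′ → j ≡ j′
Char-unique {N} {R} {mᵢ} {i} {j} {j′} χ χ′ with <-cmp j j′
... | tri< j<j′ _ _ = ⊥-elim (Char-disjoint {N} {R} {mᵢ} {i} j<j′ χ χ′)
... | tri≈ _ j≡j′ _ = j≡j′
... | tri> _ _ j′<j = ⊥-elim (Char-disjoint {N} {R} {mᵢ} {i} j′<j χ′ χ)

module _ (N : ℕ) where

  Increasing : ℕ → List ℕ → Set
  Increasing lo []       = lo ≤ N
  Increasing lo (x ∷ xs) = lo < x × Increasing x xs

  increasing? : ∀ lo → Decidable (Increasing lo)
  increasing? lo []       = lo ≤? N
  increasing? lo (x ∷ xs) = (lo <? x) ×-dec increasing? x xs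

  Increasing⇒+length≤N : ∀ {lo} xs → Increasing lo xs → lo + length xs ≤ N
  Increasing⇒+length≤N {lo} []       lo≤N          = subst (_≤ N) (sym (+-identityʳ lo)) lo≤N
  Increasing⇒+length≤N {lo} (x ∷ xs) (lo<x , incr) = begin
    lo + suc (length xs) ≡⟨ +-suc lo (length xs) ⟩
    suc lo + length xs   ≤⟨ +-monoˡ-≤ (length xs) lo<x ⟩
    x + length xs        ≤⟨ Increasing⇒+length≤N xs incr ⟩
    N                    ∎
    where open ≤-Reasoning

  Increasing⇒≤N : ∀ {lo} xs → Increasing lo xs → lo ≤ N
  Increasing⇒≤N xs incr = m+n≤o⇒m≤o _ (Increasing⇒+length≤N xs incr)

  -- The first summand is the number of increasing sequences in (lo, N] of length r+1
  -- whose first entry is below x.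
  rank : ℕ → List ℕ → ℕ
  rank lo []       = 0
  rank lo (x ∷ xs) = ((N ∸ lo) C suc r ∸ (suc N ∸ x) C suc r) + rank x xs
    where r = length xs

  rank<C : ∀ {lo} xs → Increasing lo xs → rank lo xs < (N ∸ lo) C length xs
  rank<C []            _             = s≤s z≤n
  rank<C {lo} (x ∷ xs) (lo<x , incr) = begin-strict
    (D ∸ E) + rank x xs   <⟨ +-monoʳ-< (D ∸ E) (rank<C xs incr) ⟩
    (D ∸ E) + (N ∸ x) C r ≤⟨ +-monoʳ-≤ (D ∸ E) (m≤m+n _ _) ⟩
    (D ∸ E) + ((N ∸ x) C r + (N ∸ x) C suc r)
                          ≡⟨ cong (_+_ (D ∸ E)) (pascal-∸ (s≤s (Increasing⇒≤N xs incr)) z≤n) ⟨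
    (D ∸ E) + E           ≡⟨ m∸n+n≡m ([1+n∸b]Ck≤[n∸a]Ck (suc r) lo<x) ⟩
    D                     ∎
    where
    open ≤-Reasoning
    r = length xs
    D = (N ∸ lo) C suc r
    E = (suc N ∸ x) C suc r

  count-increasing : ∀ r {lo} → lo ≤ N → count (increasing? lo ∘ toList) (allVecs N r) ≡ (N ∸ lo) C r
  count-increasing zero    {lo} lo≤N = cong length (filter-accept (increasing? lo ∘ toList) {xs = []} lo≤N)
  count-increasing (suc r) {lo} lo≤N = begin
    count (increasing? lo ∘ toList) (allVecs N (suc r)) ≡⟨ count-allVecs-suc N r _ ⟩
    sumTo N h                                           ≡⟨ +-identityʳ _ ⟨
    sumTo N h + 0                                       ≡⟨ cong (λ n → sumTo N h + n C suc r) (n∸n≡0 N) ⟨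
    sumTo N h + (N ∸ N) C suc r                         ≡⟨ hockey-stick h vanish binomial lo≤N ≤-refl ⟩
    (N ∸ lo) C suc r                                    ∎
    where
    open ≡-Reasoning
    h : ℕ → ℕ
    h y = count (λ d → increasing? lo (y ∷ toList d)) (allVecs N r)
    vanish : ∀ {y} → y ≤ lo → h y ≡ 0
    vanish y≤lo = count-none _ (λ _ (lo<y , _) → <⇒≱ lo<y y≤lo) (allVecs N r)
    binomial : ∀ {y} → lo < y → y ≤ N → h y ≡ (N ∸ y) C r
    binomial {y} lo<y y≤N =
      trans (count-≐ _ (increasing? y ∘ toList) (proj₂ , (lo<y ,_)) (allVecs N r)) (count-increasing r y≤N)

  count-lex-smaller : ∀ {r} lo (c : Vec ℕ r) → Increasing lo (toList c) →
    count (λ d → increasing? lo (toList d) ×-dec lex? d c) (allVecs N r) ≡ rank lo (toList c)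
  count-lex-smaller lo [] _ =
    count-none (λ d → increasing? lo (toList d) ×-dec lex? d []) (λ { _ (_ , ()) }) (allVecs N 0)
  count-lex-smaller {suc r} lo (x ∷ xs) (lo<x , incr) = begin
    count P? (allVecs N (suc r))
      ≡⟨ count-allVecs-suc N r P? ⟩
    sumTo N h
      ≡⟨ sumTo-first-entries h vanish binomial at-x beyond lo<x x≤N ⟩
    ((N ∸ lo) C suc r ∸ (suc N ∸ x) C suc r) + rank x (toList xs)
      ≡⟨ cong (λ k → ((N ∸ lo) C suc k ∸ (suc N ∸ x) C suc k) + rank x (toList xs))
              (length-toList xs) ⟨
    rank lo (toList (x ∷ xs)) ∎
    where
    open ≡-Reasoning
    x≤N : x ≤ N
    x≤N = Increasing⇒≤N (toList xs) incr
    P? : Decidable (λ d → Increasing lo (toList d) × d <lex (x ∷ xs))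
    P? d = increasing? lo (toList d) ×-dec lex? d (x ∷ xs)
    h : ℕ → ℕ
    h y = count (P? ∘ (y ∷_)) (allVecs N r)
    vanish : ∀ {y} → y ≤ lo → h y ≡ 0
    vanish y≤lo = count-none (P? ∘ (_ ∷_)) (λ _ ((lo<y , _) , _) → <⇒≱ lo<y y≤lo) (allVecs N r)
    binomial : ∀ {y} → lo < y → y < x → h y ≡ (N ∸ y) C r
    binomial {y} lo<y y<x =
      trans (count-≐ (P? ∘ (y ∷_)) (increasing? y ∘ toList)
                     (proj₂ ∘ proj₁ , λ incr′ → (lo<y , incr′) , here y<x) (allVecs N r))
            (count-increasing r (<⇒≤ (<-≤-trans y<x x≤N)))
    at-x : h x ≡ rank x (toList xs)
    at-x = trans (count-≐ (P? ∘ (x ∷_)) (λ d → increasing? x (toList d) ×-dec lex? d xs)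
                          ( (λ { ((_ , incr′) , here x<x) → ⊥-elim (<-irrefl refl x<x)
                               ; ((_ , incr′) , there lt)  → incr′ , lt })
                          , λ (incr′ , lt) → (lo<x , incr′) , there lt)
                          (allVecs N r))
                 (count-lex-smaller x xs incr)
    beyond : ∀ {y} → x < y → y ≤ N → h y ≡ 0
    beyond x<y _ = count-none (P? ∘ (_ ∷_))
      (λ { _ (_ , here y<x) → <-asym x<y y<x ; _ (_ , there _) → <-irrefl refl x<y }) (allVecs N r)

  Above : ℕ → ∀ {r} → Vec ℕ r → Set
  Above lo c = ∀ k → lo < lookup c k × lookup c k ≤ N

  Sorted : ∀ {r} → Vec ℕ r → Set
  Sorted c = ∀ k k′ → k Fin.< k′ → lookup c k < lookup c k′

  above-sorted⇒Increasing : ∀ {r lo} (c : Vec ℕ r) → lo ≤ N → Above lo c → Sorted c →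
                            Increasing lo (toList c)
  above-sorted⇒Increasing []       lo≤N _     _      = lo≤N
  above-sorted⇒Increasing (x ∷ xs) _    above sorted =
    proj₁ (above Fin.zero) ,
    above-sorted⇒Increasing xs (proj₂ (above Fin.zero))
      (λ k → sorted Fin.zero (Fin.suc k) z<s , proj₂ (above (Fin.suc k)))
      (λ k k′ k<k′ → sorted (Fin.suc k) (Fin.suc k′) (s<s k<k′))

  Increasing⇒above-sorted : ∀ {r lo} (c : Vec ℕ r) → Increasing lo (toList c) → Above lo c × Sorted c
  Increasing⇒above-sorted           []       _             = (λ ()) , (λ ())
  Increasing⇒above-sorted {lo = lo} (x ∷ xs) (lo<x , incr) = above , sorted
    where
    ih = Increasing⇒above-sorted xs incr
    above : Above lo (x ∷ xs)
    above Fin.zero    = lo<x , Increasing⇒≤N (toList xs) incr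
    above (Fin.suc k) = <-trans lo<x (proj₁ (proj₁ ih k)) , proj₂ (proj₁ ih k)
    sorted : Sorted (x ∷ xs)
    sorted Fin.zero    Fin.zero     ()
    sorted Fin.zero    (Fin.suc k′) _          = proj₁ (proj₁ ih k′)
    sorted (Fin.suc k) Fin.zero     ()
    sorted (Fin.suc k) (Fin.suc k′) (s<s k<k′) = proj₂ ih k k′ k<k′

  InA≐Increasing : ∀ {R} → InA N R ≐ (Increasing 0 ∘ toList)
  InA≐Increasing = (λ {c} (above , sorted) → above-sorted⇒Increasing c z≤n above sorted)
                 , (λ {c} → Increasing⇒above-sorted c)

  L≡1+rank : ∀ {R} (c : Vec ℕ R) → InA N R c → L N R c ≡ suc (rank 0 (toList c))
  L≡1+rank {R} c c∈A = cong suc (trans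
    (count-≐ (λ d → inA? N R d ×-dec lex? d c) (λ d → increasing? 0 (toList d) ×-dec lex? d c)
             ( (λ (d∈A , lt) → proj₁ InA≐Increasing d∈A , lt)
             , (λ (incr , lt) → proj₂ InA≐Increasing incr , lt))
             (allVecs N R))
    (count-lex-smaller 0 c (proj₁ InA≐Increasing c∈A)))

  rank-step : ∀ {i a b} rest → i ≤ N → a < b → b ≤ N → let K = suc (length rest) in
    + (suc (rank a (b ∷ rest)) + (suc N ∸ i) C suc K) ℤ.- + ((suc N ∸ a) C suc K)
      ℤ.- (+ ((N ∸ i) C suc K) ℤ.- + ((N ∸ a) C suc K))
    ≡ + (suc (rank b rest) + (N ∸ i) C K) ℤ.- + ((suc N ∸ b) C K)
  rank-step {i} {a} {b} rest i≤N a<b b≤N = begin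
    + (suc (s + f) + (suc N ∸ i) C suc K) ℤ.- + ((suc N ∸ a) C suc K) ℤ.- (+ q ℤ.- + v)
      ≡⟨ cong₂ (λ A X → + (suc (s + f) + A) ℤ.- + X ℤ.- (+ q ℤ.- + v))
               (pascal-∸ (s≤s i≤N) z≤n)
               (trans (pascal-∸ (s≤s (<⇒≤ (<-≤-trans a<b b≤N))) z≤n) (cong (_+ v) (sym block))) ⟩
    + (suc (s + f) + (p + q)) ℤ.- + ((s + w) + v) ℤ.- (+ q ℤ.- + v)
      ≡⟨ telescope (+ s) (+ f) (+ p) (+ q) (+ v) (+ w) ⟩
    + (suc f + p) ℤ.- + w ∎
    where
    open ≡-Reasoning
    K = suc (length rest)
    s = (N ∸ a) C K ∸ (suc N ∸ b) C K
    f = rank b rest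
    p = (N ∸ i) C K
    q = (N ∸ i) C suc K
    v = (N ∸ a) C suc K
    w = (suc N ∸ b) C K
    block : s + w ≡ (N ∸ a) C K
    block = m∸n+n≡m ([1+n∸b]Ck≤[n∸a]Ck K a<b)
    telescope : ∀ s f p q v w →
      (+ 1 ℤ.+ (s ℤ.+ f) ℤ.+ (p ℤ.+ q)) ℤ.- ((s ℤ.+ w) ℤ.+ v) ℤ.- (q ℤ.- v) ≡ (+ 1 ℤ.+ f ℤ.+ p) ℤ.- w
    telescope = solve-∀

nth-zero : ∀ {R} (c : Vec ℕ R) → nth c 0 ≡ 0
nth-zero []      = refl
nth-zero (_ ∷ _) = refl

suffix : ∀ {R} → Vec ℕ R → ℕ → List ℕ
suffix c i = drop i (toList c)

suffix-∷ : ∀ {R} (c : Vec ℕ R) {i} → i < R → suffix c i ≡ nth c (suc i) ∷ suffix c (suc i)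
suffix-∷ (x ∷ xs) {zero}  _         = refl
suffix-∷ (x ∷ xs) {suc i} (s<s i<R) = suffix-∷ xs i<R

length-suffix : ∀ {R} (c : Vec ℕ R) i → length (suffix c i) ≡ R ∸ i
length-suffix c i = trans (length-drop i (toList c)) (cong (_∸ i) (length-toList c))

mSeq-suc : ∀ N {R} (c : Vec ℕ R) m i → mSeq N R c m (suc i)
  ≡ mSeq N R c m i ℤ.- (+ ((N ∸ i) C (suc R ∸ i)) ℤ.- + ((N ∸ nth c i) C (suc R ∸ i)))
mSeq-suc N {R} c m zero rewrite nth-zero c = minus-zero (+ m ℤ.- + 0) (+ (N C suc R))
  where
  minus-zero : ∀ a x → a ≡ a ℤ.- (x ℤ.- x)
  minus-zero = solve-∀
mSeq-suc N {R} c m (suc i) =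
  trans (cong (λ s → + m ℤ.- s) (foldr-map-applyUpTo-suc ℤP.+-0-isMonoid term i))
        (minus-+ (+ m) (sumℤ (map term (applyUpTo suc i))) (term (suc i)))
  where
  term : ℕ → ℤ
  term l = + ((N ∸ l) C (suc R ∸ l)) ℤ.- + ((N ∸ nth c l) C (suc R ∸ l))
  minus-+ : ∀ a s t → a ℤ.- (s ℤ.+ t) ≡ a ℤ.- s ℤ.- t
  minus-+ = solve-∀

module _ {N R : ℕ} (c : Vec ℕ R) (incr : Increasing N 0 (toList c)) where

  Increasing-suffix   : ∀ {i} → i ≤ R → Increasing N (nth c i) (suffix c i)
  Increasing-suffix-∷ : ∀ {i} → i < R → Increasing N (nth c i) (nth c (suc i) ∷ suffix c (suc i))

  Increasing-suffix {zero}  _   = subst (λ lo → Increasing N lo (toList c)) (sym (nth-zero c)) incr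
  Increasing-suffix {suc i} i<R = proj₂ (Increasing-suffix-∷ i<R)

  Increasing-suffix-∷ i<R = subst (Increasing N _) (suffix-∷ c i<R) (Increasing-suffix (<⇒≤ i<R))

  nth≤N : ∀ {i} → i ≤ R → nth c i ≤ N
  nth≤N {i} i≤R = Increasing⇒≤N N (suffix c i) (Increasing-suffix i≤R)

  i≤nth : ∀ {i} → i ≤ R → i ≤ nth c i
  i≤nth {zero}  _   = z≤n
  i≤nth {suc i} i<R = ≤-trans (s≤s (i≤nth (<⇒≤ i<R))) (proj₁ (Increasing-suffix-∷ i<R))

  nth≤N∸R+i : R ≤ N → ∀ {i} → i ≤ R → nth c i ≤ N ∸ R + i
  nth≤N∸R+i R≤N {i} i≤R = +-cancelʳ-≤ (R ∸ i) (nth c i) (N ∸ R + i) (begin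
    nth c i + (R ∸ i)             ≡⟨ cong (_+_ (nth c i)) (length-suffix c i) ⟨
    nth c i + length (suffix c i) ≤⟨ Increasing⇒+length≤N N (suffix c i) (Increasing-suffix i≤R) ⟩
    N                             ≡⟨ m∸n+n≡m R≤N ⟨
    N ∸ R + R                     ≡⟨ cong (_+_ (N ∸ R)) (m+[n∸m]≡n i≤R) ⟨
    N ∸ R + (i + (R ∸ i))         ≡⟨ +-assoc (N ∸ R) i (R ∸ i) ⟨
    N ∸ R + i + (R ∸ i)           ∎)
    where open ≤-Reasoning

  -- Since c₀ = nth c 0 = 0 the invariant already holds at i = 0, where its two binomials coincide.
  mSeq-rank : ∀ {i} → i ≤ R → mSeq N R c (suc (rank N 0 (toList c))) i
    ≡ + (suc (rank N (nth c i) (suffix c i)) + (suc N ∸ i) C (suc R ∸ i))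
      ℤ.- + ((suc N ∸ nth c i) C (suc R ∸ i))
  mSeq-rank {zero} _ rewrite nth-zero c = shift (+ suc (rank N 0 (toList c))) (+ (suc N C suc R))
    where
    shift : ∀ a x → a ℤ.- + 0 ≡ (a ℤ.+ x) ℤ.- x
    shift = solve-∀
  mSeq-rank {suc i} i<R = begin
    mSeq N R c m₀ (suc i)     ≡⟨ mSeq-suc N c m₀ i ⟩
    mSeq N R c m₀ i ℤ.- tᵢ    ≡⟨ cong (ℤ._- tᵢ) (mSeq-rank (<⇒≤ i<R)) ⟩
    invariantᵢ ℤ.- tᵢ         ≡⟨ step ⟩
    + (suc (rank N (nth c (suc i)) (suffix c (suc i))) + (N ∸ i) C (R ∸ i))
      ℤ.- + ((suc N ∸ nth c (suc i)) C (R ∸ i)) ∎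
    where
    open ≡-Reasoning
    m₀ = suc (rank N 0 (toList c))
    tᵢ = + ((N ∸ i) C (suc R ∸ i)) ℤ.- + ((N ∸ nth c i) C (suc R ∸ i))
    invariantᵢ = + (suc (rank N (nth c i) (suffix c i)) + (suc N ∸ i) C (suc R ∸ i))
                 ℤ.- + ((suc N ∸ nth c i) C (suc R ∸ i))
    step : invariantᵢ ℤ.- tᵢ
         ≡ + (suc (rank N (nth c (suc i)) (suffix c (suc i))) + (N ∸ i) C (R ∸ i))
           ℤ.- + ((suc N ∸ nth c (suc i)) C (R ∸ i))
    step rewrite suffix-∷ c i<R | +-∸-assoc 1 (<⇒≤ i<R) | +-∸-assoc 1 i<R
               | sym (length-suffix c (suc i)) =
      rank-step N (suffix c (suc i)) (≤-trans (i≤nth (<⇒≤ i<R)) (nth≤N (<⇒≤ i<R)))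
                (proj₁ (Increasing-suffix-∷ i<R)) (nth≤N i<R)

  Char-nth : ∀ {i} → i ≤ R → Char N R (mSeq N R c (suc (rank N 0 (toList c))) i) i (nth c i)
  Char-nth {i} i≤R = subst (λ mᵢ → Char N R mᵢ i (nth c i)) (sym (mSeq-rank i≤R))
    (window ((suc N ∸ i) C (suc R ∸ i)) ((N ∸ nth c i) C (suc R ∸ i))
            (pascal-∸ (s≤s (nth≤N i≤R)) i≤R) tail-rank<C)
    where
    tail-rank<C : rank N (nth c i) (suffix c i) < (N ∸ nth c i) C (R ∸ i)
    tail-rank<C = subst (λ k → rank N (nth c i) (suffix c i) < (N ∸ nth c i) C k) (length-suffix c i)
                        (rank<C N (suffix c i) (Increasing-suffix i≤R))

proposition4p2 : (N R : ℕ) → 1 ≤ R → R ≤ N → (c : Vec ℕ R) → InA N R c →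
    (i : ℕ) → 1 ≤ i → i ≤ R →
    (i ≤ nth c i × nth c i ≤ N ∸ R + i × Char N R (mSeq N R c (L N R c) i) i (nth c i))
    × ((j : ℕ) → i ≤ j → j ≤ N ∸ R + i → Char N R (mSeq N R c (L N R c) i) i j → j ≡ nth c i)
proposition4p2 N R _ R≤N c c∈A i _ i≤R rewrite L≡1+rank N c c∈A =
    (i≤nth c incr i≤R , nth≤N∸R+i c incr R≤N i≤R , Char-nth c incr i≤R)
  , λ j _ _ χⱼ → Char-unique {N} {R} {i = i} χⱼ (Char-nth c incr i≤R)
  where
  incr : Increasing N 0 (toList c)
  incr = proj₁ (InA≐Increasing N) c∈A
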